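{- Let $k,n$ be positive integers with $n\ge k\ge e\log n+e$. Then $S(k,n)$ is not an integer.
   Context: For positive integers $k\le n$, $S(k,n)$ denotes the $k$-th elementary symmetric function of $1, 1/2, \ldots, 1/n$, i.e. $S(k,n)=\sum_{1\le i_1<i_2<\cdots<i_k\le n}\frac{1}{i_1 i_2\cdots i_k}$. Here $\log$ is the natural logarithm and $e$ is Euler's number. -}

module Defs where

open import Data.Nat as ℕ using (ℕ; zero; suc; _∸_)
open import Data.Nat using (_!)
open import Data.Nat.Properties using (_!≢0)
open import Data.Integer using (ℤ; +_)
open import Data.Rational using (ℚ; _/_; _+_; _*_; 0ℚ; 1ℚ; _≤_)
open import Data.List using (List; []; _∷_; map; foldr; upTo)
open import Data.Product using (∃)
open import Relation.Binary.PropositionalEquality using (_≡_)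

-- reciprocal of a natural number as a rational (1/0 := 0, never used: entries are ≥ 1)
inv : ℕ → ℚ
inv zero    = 0ℚ
inv (suc m) = + 1 / suc m

-- all k-element sublists of a list (order preserved), i.e. all i₁ < … < iₖ
choose : ℕ → List ℕ → List (List ℕ)
choose zero    _        = [] ∷ []
choose (suc k) []       = []
choose (suc k) (x ∷ xs) = map (x ∷_) (choose k xs) Data.List.++ choose (suc k) xs
  where import Data.List

sumℚ : List ℚ → ℚ
sumℚ = foldr _+_ 0ℚ

prodℚ : List ℚ → ℚ
prodℚ = foldr _*_ 1ℚ

oneTo : ℕ → List ℕ
oneTo n = map suc (upTo n)

S : ℕ → ℕ → ℚ
S k n = sumℚ (map (λ c → prodℚ (map inv c)) (choose k (oneTo n)))

IsInteger : ℚ → Set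
IsInteger q = ∃ λ (z : ℤ) → q ≡ z / 1

powℚ : ℚ → ℕ → ℚ
powℚ q zero    = 1ℚ
powℚ q (suc m) = q * powℚ q m

eApprox : ℕ → ℚ
eApprox m = sumℚ (map (λ j → _/_ (+ 1) (j !) {{j !≢0}}) (upTo m))

-- partial sums of log n = 2 Σ_{j≥0} t^{2j+1}/(2j+1), t = (n-1)/(n+1)  (n ≥ 1;
-- increasing, converging to log n)
logApprox : ℕ → ℕ → ℚ
logApprox n m =
  (+ 2 / 1) * sumℚ (map (λ j → powℚ t (suc (2 ℕ.* j)) * (+ 1 / suc (2 ℕ.* j))) (upTo m))
  where t = + (n ∸ 1) / suc n

-- The real inequality  e·log n + e ≤ k  (for n ≥ 1), expressed as: every
-- (increasing) rational approximation of the left side is ≤ k.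
ElogPlusE≤ : ℕ → ℕ → Set
ElogPlusE≤ n k = ∀ m → eApprox m * (logApprox n m + 1ℚ) ≤ (+ k / 1)

{-# OPTIONS --safe #-}
module Submission where

-- Let H = 1 + 1/2 + ⋯ + 1/n, and let E and L be the partial sums of ∑ 1/i! and of
-- 2·artanh((n-1)/(n+1)) = log n for which the hypothesis gives E·(L + 1) ≤ k.
-- Expanding H^k gives k!·S(k,n) ≤ H^k, and S(k,n) > 0 as k ≤ n. Each 1/(r+2) is at most the
-- increment of the partial artanh series between r/(r+2) and (r+1)/(r+3), so H ≤ L + 1.
-- Since k^k/k! is the product of the (1 + 1/j)^j for j < k, each at most E, k^k ≤ E^(k-1)·k! < E^k·k!.
-- Hence (E·H)^k ≤ k^k < E^k·k!, so H^k < k! and 0 < S(k,n) < 1.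

open import Defs
open import Data.Nat as ℕ using (ℕ; zero; suc; _!)
import Data.Nat.Properties as ℕP
import Data.Nat.Solver
open import Data.Integer as ℤ using (+_; -[1+_])
import Data.Integer.Properties as ℤP
import Data.Integer.Solver
open import Data.Rational as ℚ using (ℚ; _/_; _+_; _*_; _-_; 0ℚ; 1ℚ; toℚᵘ)
import Data.Rational.Properties as ℚP
import Data.Rational.Solver
open import Data.Rational.Unnormalised as ℚᵘ using (mkℚᵘ; *≡*)
import Data.Rational.Unnormalised.Properties as ℚᵘP
open import Data.List using (List; []; _∷_; map; upTo; _++_; [_]; length)
import Data.List.Properties as LP
open import Data.Product using (_,_)
open import Data.Empty using (⊥-elim-irr)
open import Relation.Nullary using (¬_)
open import Relation.Binary.PropositionalEquality
  using (_≡_; refl; sym; trans; cong; cong₂; subst; subst₂; module ≡-Reasoning)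

module QS = Data.Rational.Solver.+-*-Solver
module NS = Data.Nat.Solver.+-*-Solver
module ZS = Data.Integer.Solver.+-*-Solver

-- A separate module keeps the order on ℚ out of scope of the final statement, which uses the one on ℕ.
module Estimates where

  open import Data.Rational using (_≤_; _<_)

  ι : ℕ → ℚ
  ι a = + a / 1

  toℚᵘ-ι : ∀ a → toℚᵘ (ι a) ℚᵘ.≃ mkℚᵘ (+ a) 0
  toℚᵘ-ι a = ℚP.toℚᵘ-fromℚᵘ (mkℚᵘ (+ a) 0)

  toℚᵘ-/ : ∀ x b → toℚᵘ (+ x / suc b) ℚᵘ.≃ mkℚᵘ (+ x) b
  toℚᵘ-/ x b = ℚP.toℚᵘ-fromℚᵘ (mkℚᵘ (+ x) b)

  toℚᵘ-+ : ∀ p q {u v} → toℚᵘ p ℚᵘ.≃ u → toℚᵘ q ℚᵘ.≃ v → toℚᵘ (p + q) ℚᵘ.≃ u ℚᵘ.+ v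
  toℚᵘ-+ p q p≃u q≃v = ℚᵘP.≃-trans (ℚP.toℚᵘ-homo-+ p q) (ℚᵘP.+-cong p≃u q≃v)

  toℚᵘ-* : ∀ p q {u v} → toℚᵘ p ℚᵘ.≃ u → toℚᵘ q ℚᵘ.≃ v → toℚᵘ (p * q) ℚᵘ.≃ u ℚᵘ.* v
  toℚᵘ-* p q p≃u q≃v = ℚᵘP.≃-trans (ℚP.toℚᵘ-homo-* p q) (ℚᵘP.*-cong p≃u q≃v)

  ≡-via-toℚᵘ : ∀ {p q u v} → toℚᵘ p ℚᵘ.≃ u → toℚᵘ q ℚᵘ.≃ v → u ℚᵘ.≃ v → p ≡ q
  ≡-via-toℚᵘ p≃u q≃v u≃v = ℚP.toℚᵘ-injective (ℚᵘP.≃-trans p≃u (ℚᵘP.≃-trans u≃v (ℚᵘP.≃-sym q≃v)))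

  ι-homo-+ : ∀ a b → ι (a ℕ.+ b) ≡ ι a + ι b
  ι-homo-+ a b = ≡-via-toℚᵘ (toℚᵘ-ι (a ℕ.+ b)) (toℚᵘ-+ (ι a) (ι b) (toℚᵘ-ι a) (toℚᵘ-ι b))
    (*≡* (trans (cong (ℤ._* + 1) (ℤP.pos-+ a b))
      (ZS.solve 2 (λ x y → (x :+ y) :* con (+ 1) := (x :* con (+ 1) :+ y :* con (+ 1)) :* con (+ 1)) refl (+ a) (+ b))))
    where open ZS

  ι-homo-* : ∀ a b → ι (a ℕ.* b) ≡ ι a * ι b
  ι-homo-* a b = ≡-via-toℚᵘ (toℚᵘ-ι (a ℕ.* b)) (toℚᵘ-* (ι a) (ι b) (toℚᵘ-ι a) (toℚᵘ-ι b))
    (*≡* (cong (ℤ._* + 1) (ℤP.pos-* a b)))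

  ι-mono-≤ : ∀ {a b} → a ℕ.≤ b → ι a ≤ ι b
  ι-mono-≤ {a} {b} a≤b = ℚP.toℚᵘ-cancel-≤
    (ℚᵘP.≤-respʳ-≃ (ℚᵘP.≃-sym (toℚᵘ-ι b)) (ℚᵘP.≤-respˡ-≃ (ℚᵘP.≃-sym (toℚᵘ-ι a))
      (ℚᵘ.*≤* (subst₂ ℤ._≤_ (sym (ℤP.*-identityʳ (+ a))) (sym (ℤP.*-identityʳ (+ b))) (ℤ.+≤+ a≤b)))))

  ι-mono-< : ∀ {a b} → a ℕ.< b → ι a < ι b
  ι-mono-< {a} {b} a<b = ℚP.toℚᵘ-cancel-<
    (ℚᵘP.<-respʳ-≃ (ℚᵘP.≃-sym (toℚᵘ-ι b)) (ℚᵘP.<-respˡ-≃ (ℚᵘP.≃-sym (toℚᵘ-ι a))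
      (ℚᵘ.*<* (subst₂ ℤ._<_ (sym (ℤP.*-identityʳ (+ a))) (sym (ℤP.*-identityʳ (+ b))) (ℤ.+<+ a<b)))))

  ι-nonNeg : ∀ a → 0ℚ ≤ ι a
  ι-nonNeg a = ι-mono-≤ {0} {a} ℕ.z≤n

  ι-pos : ∀ a → 0ℚ < ι (suc a)
  ι-pos a = ι-mono-< {0} {suc a} (ℕ.s≤s ℕ.z≤n)

  /-nonNeg : ∀ x b → 0ℚ ≤ + x / suc b
  /-nonNeg x b = ℚP.nonNegative⁻¹ (+ x / suc b) {{ℚP.normalize-nonNeg x (suc b)}}

  inv-nonNeg : ∀ x → 0ℚ ≤ inv x
  inv-nonNeg zero    = ℚP.≤-refl
  inv-nonNeg (suc m) = /-nonNeg 1 m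

  inv-pos : ∀ m → 0ℚ < inv (suc m)
  inv-pos m = ℚP.positive⁻¹ (+ 1 / suc m) {{ℚP.normalize-pos 1 (suc m)}}

  +-nonNeg : ∀ {p q} → 0ℚ ≤ p → 0ℚ ≤ q → 0ℚ ≤ p + q
  +-nonNeg = ℚP.+-mono-≤

  *-nonNeg : ∀ {p q} → 0ℚ ≤ p → 0ℚ ≤ q → 0ℚ ≤ p * q
  *-nonNeg {p} {q} p≥0 q≥0 =
    ℚP.nonNegative⁻¹ (p * q) {{ℚP.nonNeg*nonNeg⇒nonNeg p {{ℚ.nonNegative p≥0}} q {{ℚ.nonNegative q≥0}}}}

  *-pos : ∀ {p q} → 0ℚ < p → 0ℚ < q → 0ℚ < p * q
  *-pos {p} {q} p>0 q>0 = ℚP.positive⁻¹ (p * q) {{ℚP.pos*pos⇒pos p {{ℚ.positive p>0}} q {{ℚ.positive q>0}}}}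

  p≤p+q : ∀ p {q} → 0ℚ ≤ q → p ≤ p + q
  p≤p+q p {q} q≥0 = subst (_≤ p + q) (ℚP.+-identityʳ p) (ℚP.+-monoʳ-≤ p q≥0)

  *-monoˡ-≤ : ∀ r {p q} → 0ℚ ≤ r → p ≤ q → r * p ≤ r * q
  *-monoˡ-≤ r r≥0 = ℚP.*-monoˡ-≤-nonNeg r {{ℚ.nonNegative r≥0}}

  *-monoʳ-≤ : ∀ r {p q} → 0ℚ ≤ r → p ≤ q → p * r ≤ q * r
  *-monoʳ-≤ r r≥0 = ℚP.*-monoʳ-≤-nonNeg r {{ℚ.nonNegative r≥0}}

  *-mono-≤ : ∀ {p q r s} → 0ℚ ≤ q → 0ℚ ≤ r → p ≤ q → r ≤ s → p * r ≤ q * s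
  *-mono-≤ {r = r} {s} q≥0 r≥0 p≤q r≤s = ℚP.≤-trans (*-monoʳ-≤ r r≥0 p≤q) (*-monoˡ-≤ _ q≥0 r≤s)

  *-cancelʳ-≡ : ∀ p q r → 0ℚ < r → p * r ≡ q * r → p ≡ q
  *-cancelʳ-≡ p q r r>0 pr≡qr = begin
    p             ≡⟨ sym (ℚP.*-identityʳ p) ⟩
    p * 1ℚ        ≡⟨ cong (p *_) (sym (ℚP.*-inverseʳ r)) ⟩
    p * (r * r⁻¹) ≡⟨ sym (ℚP.*-assoc p r r⁻¹) ⟩
    p * r * r⁻¹   ≡⟨ cong (_* r⁻¹) pr≡qr ⟩
    q * r * r⁻¹   ≡⟨ ℚP.*-assoc q r r⁻¹ ⟩
    q * (r * r⁻¹) ≡⟨ cong (q *_) (ℚP.*-inverseʳ r) ⟩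
    q * 1ℚ        ≡⟨ ℚP.*-identityʳ q ⟩
    q             ∎
    where
    open ≡-Reasoning
    instance
      r≢0 : ℚ.NonZero r
      r≢0 = ℚP.pos⇒nonZero r {{ℚ.positive r>0}}
    r⁻¹ : ℚ
    r⁻¹ = ℚ.1/ r

  x/d*d≡x : ∀ x d .{{_ : ℕ.NonZero d}} → (+ x / d) * ι d ≡ ι x
  x/d*d≡x x zero    {{d≢0}} = ⊥-elim-irr (ℕ.NonZero.nonZero d≢0)
  x/d*d≡x x (suc d) = ≡-via-toℚᵘ (toℚᵘ-* (+ x / suc d) (ι (suc d)) (toℚᵘ-/ x d) (toℚᵘ-ι (suc d))) (toℚᵘ-ι x)
    (*≡* (trans (ZS.solve 2 (λ u v → (u :* v) :* con (+ 1) := u :* v) refl (+ x) (+ suc d))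
                (cong (λ z → + x ℤ.* + suc z) (sym (ℕP.*-identityʳ d)))))
    where open ZS

  x/d≡x*1/d : ∀ x d → + x / suc d ≡ ι x * (+ 1 / suc d)
  x/d≡x*1/d x d = *-cancelʳ-≡ _ _ (ι (suc d)) (ι-pos d) (begin
    + x / suc d * ι (suc d)           ≡⟨ x/d*d≡x x (suc d) ⟩
    ι x                               ≡⟨ sym (ℚP.*-identityʳ (ι x)) ⟩
    ι x * 1ℚ                          ≡⟨ cong (ι x *_) (sym (x/d*d≡x 1 (suc d))) ⟩
    ι x * (+ 1 / suc d * ι (suc d))   ≡⟨ sym (ℚP.*-assoc (ι x) (+ 1 / suc d) (ι (suc d))) ⟩
    ι x * (+ 1 / suc d) * ι (suc d)   ∎)
    where open ≡-Reasoning

  x≡x*u : ∀ {u} → u ≡ 1ℚ → ∀ x → x ≡ x * u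
  x≡x*u u≡1 x = trans (sym (ℚP.*-identityʳ x)) (cong (x *_) (sym u≡1))

  0<q<1⇒¬IsInteger : ∀ {q} → 0ℚ < q → q < 1ℚ → ¬ IsInteger q
  0<q<1⇒¬IsInteger q>0 q<1 (+ zero , refl) = ℚP.<-irrefl refl q>0
  0<q<1⇒¬IsInteger q>0 q<1 (+ suc a , refl) = ℚP.<-irrefl refl (ℚP.<-≤-trans q<1 (ι-mono-≤ {1} {suc a} (ℕ.s≤s ℕ.z≤n)))
  0<q<1⇒¬IsInteger q>0 q<1 (-[1+ a ] , refl) = ℚP.<-asym q>0
    (ℚP.negative⁻¹ (-[1+ a ] / 1) {{ℚP.neg-pos {ℚ.normalize (suc a) 1} (ℚP.normalize-pos (suc a) 1)}})

  ∑ : (ℕ → ℚ) → ℕ → ℚ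
  ∑ f zero    = 0ℚ
  ∑ f (suc n) = ∑ f n + f n

  sumℚ-++ : ∀ xs ys → sumℚ (xs ++ ys) ≡ sumℚ xs + sumℚ ys
  sumℚ-++ []       ys = sym (ℚP.+-identityˡ (sumℚ ys))
  sumℚ-++ (x ∷ xs) ys = trans (cong (_+_ x) (sumℚ-++ xs ys)) (sym (ℚP.+-assoc x (sumℚ xs) (sumℚ ys)))

  sumℚ-map-upTo : ∀ f n → sumℚ (map f (upTo n)) ≡ ∑ f n
  sumℚ-map-upTo f zero    = refl
  sumℚ-map-upTo f (suc n) = begin
    sumℚ (map f (upTo (suc n)))        ≡⟨ cong (λ l → sumℚ (map f l)) (sym (LP.upTo-∷ʳ n)) ⟩
    sumℚ (map f (upTo n ++ [ n ]))      ≡⟨ cong sumℚ (LP.map-++ f (upTo n) [ n ]) ⟩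
    sumℚ (map f (upTo n) ++ [ f n ])    ≡⟨ sumℚ-++ (map f (upTo n)) [ f n ] ⟩
    sumℚ (map f (upTo n)) + (f n + 0ℚ)  ≡⟨ cong₂ _+_ (sumℚ-map-upTo f n) (ℚP.+-identityʳ (f n)) ⟩
    ∑ f n + f n                         ∎
    where open ≡-Reasoning

  sumℚ-map-*ˡ : ∀ {A : Set} r (f : A → ℚ) xs → sumℚ (map (λ x → r * f x) xs) ≡ r * sumℚ (map f xs)
  sumℚ-map-*ˡ r f []       = sym (ℚP.*-zeroʳ r)
  sumℚ-map-*ˡ r f (x ∷ xs) = trans (cong (_+_ (r * f x)) (sumℚ-map-*ˡ r f xs)) (sym (ℚP.*-distribˡ-+ r (f x) _))

  ∑-cong : ∀ {f g} → (∀ i → f i ≡ g i) → ∀ n → ∑ f n ≡ ∑ g n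
  ∑-cong f≡g zero    = refl
  ∑-cong f≡g (suc n) = cong₂ _+_ (∑-cong f≡g n) (f≡g n)

  ∑-mono-≤ : ∀ {f g} → (∀ i → f i ≤ g i) → ∀ n → ∑ f n ≤ ∑ g n
  ∑-mono-≤ f≤g zero    = ℚP.≤-refl
  ∑-mono-≤ f≤g (suc n) = ℚP.+-mono-≤ (∑-mono-≤ f≤g n) (f≤g n)

  ∑-nonNeg : ∀ {f} → (∀ i → 0ℚ ≤ f i) → ∀ n → 0ℚ ≤ ∑ f n
  ∑-nonNeg f≥0 zero    = ℚP.≤-refl
  ∑-nonNeg f≥0 (suc n) = +-nonNeg (∑-nonNeg f≥0 n) (f≥0 n)

  ∑-monoʳ-≤ : ∀ {f} → (∀ i → 0ℚ ≤ f i) → ∀ {m n} → m ℕ.≤ n → ∑ f m ≤ ∑ f n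
  ∑-monoʳ-≤ {f} f≥0 {m} m≤n = go (ℕP.≤⇒≤′ m≤n)
    where
    go : ∀ {n} → m ℕ.≤′ n → ∑ f m ≤ ∑ f n
    go ℕ.≤′-refl        = ℚP.≤-refl
    go (ℕ.≤′-step m≤′n) = ℚP.≤-trans (go m≤′n) (p≤p+q _ (f≥0 _))

  ∑-distrib-+ : ∀ f g n → ∑ (λ i → f i + g i) n ≡ ∑ f n + ∑ g n
  ∑-distrib-+ f g zero    = refl
  ∑-distrib-+ f g (suc n) = trans (cong (_+ (f n + g n)) (∑-distrib-+ f g n))
    (QS.solve 4 (λ a b c d → (a :+ b) :+ (c :+ d) := (a :+ c) :+ (b :+ d)) refl (∑ f n) (∑ g n) (f n) (g n))
    where open QS

  ∑-*ˡ : ∀ c f n → ∑ (λ i → c * f i) n ≡ c * ∑ f n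
  ∑-*ˡ c f zero    = sym (ℚP.*-zeroʳ c)
  ∑-*ˡ c f (suc n) = trans (cong (_+ c * f n) (∑-*ˡ c f n)) (sym (ℚP.*-distribˡ-+ c (∑ f n) (f n)))

  infixr 8 _^_
  _^_ : ℚ → ℕ → ℚ
  _^_ = powℚ

  ^-nonNeg : ∀ {q} → 0ℚ ≤ q → ∀ n → 0ℚ ≤ q ^ n
  ^-nonNeg q≥0 zero    = ι-nonNeg 1
  ^-nonNeg q≥0 (suc n) = *-nonNeg q≥0 (^-nonNeg q≥0 n)

  ^-pos : ∀ {q} → 0ℚ < q → ∀ n → 0ℚ < q ^ n
  ^-pos q>0 zero    = ι-pos 0
  ^-pos q>0 (suc n) = *-pos q>0 (^-pos q>0 n)

  ^-distribʳ-* : ∀ p q n → (p * q) ^ n ≡ p ^ n * q ^ n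
  ^-distribʳ-* p q zero    = refl
  ^-distribʳ-* p q (suc n) = trans (cong (p * q *_) (^-distribʳ-* p q n))
    (QS.solve 4 (λ a b c d → (a :* b) :* (c :* d) := (a :* c) :* (b :* d)) refl p q (p ^ n) (q ^ n))
    where open QS

  ^-monoˡ-≤ : ∀ {p q} → 0ℚ ≤ p → p ≤ q → ∀ n → p ^ n ≤ q ^ n
  ^-monoˡ-≤ p≥0 p≤q zero    = ℚP.≤-refl
  ^-monoˡ-≤ p≥0 p≤q (suc n) = *-mono-≤ (ℚP.≤-trans p≥0 p≤q) (^-nonNeg p≥0 n) p≤q (^-monoˡ-≤ p≥0 p≤q n)

  ι-homo-^ : ∀ a n → ι a ^ n ≡ ι (a ℕ.^ n)
  ι-homo-^ a zero    = refl
  ι-homo-^ a (suc n) = trans (cong (ι a *_) (ι-homo-^ a n)) (sym (ι-homo-* a (a ℕ.^ n)))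

  1^n≡1 : ∀ n → 1ℚ ^ n ≡ 1ℚ
  1^n≡1 zero    = refl
  1^n≡1 (suc n) = trans (cong (1ℚ *_) (1^n≡1 n)) (ℚP.*-identityˡ 1ℚ)

  [a+d]^[1+p]≥two-terms : ∀ {a d} → 0ℚ ≤ a → 0ℚ ≤ d → ∀ p →
                          a ^ suc p + ι (suc p) * d * a ^ p ≤ (a + d) ^ suc p
  [a+d]^[1+p]≥two-terms {a} {d} a≥0 d≥0 zero = ℚP.≤-reflexive
    (QS.solve 2 (λ a d → a :* con 1ℚ :+ con 1ℚ :* d :* con 1ℚ := (a :+ d) :* con 1ℚ) refl a d)
    where open QS
  [a+d]^[1+p]≥two-terms {a} {d} a≥0 d≥0 (suc p) = begin
    a * (a * P) + ι (2 ℕ.+ p) * d * (a * P)                       ≤⟨ p≤p+q _ dropped≥0 ⟩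
    a * (a * P) + ι (2 ℕ.+ p) * d * (a * P) + J * d * d * P       ≡⟨ expand ⟩
    (a + d) * (a * P + J * d * P)                                 ≤⟨ *-monoˡ-≤ (a + d) (+-nonNeg a≥0 d≥0)
                                                                       ([a+d]^[1+p]≥two-terms a≥0 d≥0 p) ⟩
    (a + d) * (a + d) ^ suc p                                     ∎
    where
    open ℚP.≤-Reasoning
    P : ℚ
    P = a ^ p
    J : ℚ
    J = ι (suc p)
    dropped≥0 : 0ℚ ≤ J * d * d * P
    dropped≥0 = *-nonNeg (*-nonNeg (*-nonNeg (ι-nonNeg (suc p)) d≥0) d≥0) (^-nonNeg a≥0 p)
    expand : a * (a * P) + ι (2 ℕ.+ p) * d * (a * P) + J * d * d * P ≡ (a + d) * (a * P + J * d * P)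
    expand = trans (cong (λ z → a * (a * P) + z * d * (a * P) + J * d * d * P) (ι-homo-+ 1 (suc p)))
      (QS.solve 4 (λ a d P J → a :* (a :* P) :+ (con 1ℚ :+ J) :* d :* (a :* P) :+ J :* d :* d :* P
                   := (a :+ d) :* (a :* P :+ J :* d :* P)) refl a d P J)
      where open QS

  symInv : ℕ → List ℕ → ℚ
  symInv k xs = sumℚ (map (λ c → prodℚ (map inv c)) (choose k xs))

  sumInv : List ℕ → ℚ
  sumInv xs = sumℚ (map inv xs)

  symInv-zero : ∀ xs → symInv 0 xs ≡ 1ℚ
  symInv-zero xs = ℚP.+-identityʳ 1ℚ

  symInv-cons : ∀ k x xs → symInv (suc k) (x ∷ xs) ≡ inv x * symInv k xs + symInv (suc k) xs
  symInv-cons k x xs = begin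
    sumℚ (map g (map (x ∷_) (choose k xs) ++ choose (suc k) xs))
      ≡⟨ cong sumℚ (LP.map-++ g (map (x ∷_) (choose k xs)) (choose (suc k) xs)) ⟩
    sumℚ (map g (map (x ∷_) (choose k xs)) ++ map g (choose (suc k) xs))
      ≡⟨ sumℚ-++ (map g (map (x ∷_) (choose k xs))) _ ⟩
    sumℚ (map g (map (x ∷_) (choose k xs))) + symInv (suc k) xs
      ≡⟨ cong (λ z → sumℚ z + symInv (suc k) xs) (sym (LP.map-∘ (choose k xs))) ⟩
    sumℚ (map (λ c → inv x * g c) (choose k xs)) + symInv (suc k) xs
      ≡⟨ cong (_+ symInv (suc k) xs) (sumℚ-map-*ˡ (inv x) g (choose k xs)) ⟩
    inv x * symInv k xs + symInv (suc k) xs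
      ∎
    where
    open ≡-Reasoning
    g : List ℕ → ℚ
    g c = prodℚ (map inv c)

  symInv-nonNeg : ∀ k xs → 0ℚ ≤ symInv k xs
  symInv-nonNeg zero    xs       = ℚP.≤-trans (ι-nonNeg 1) (ℚP.≤-reflexive (sym (symInv-zero xs)))
  symInv-nonNeg (suc k) []       = ℚP.≤-refl
  symInv-nonNeg (suc k) (x ∷ xs) = subst (0ℚ ≤_) (sym (symInv-cons k x xs))
    (+-nonNeg (*-nonNeg (inv-nonNeg x) (symInv-nonNeg k xs)) (symInv-nonNeg (suc k) xs))

  symInv-pos : ∀ k ys → k ℕ.≤ length ys → 0ℚ < symInv k (map suc ys)
  symInv-pos zero    ys       _           = subst (0ℚ <_) (sym (symInv-zero (map suc ys))) (ι-pos 0)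
  symInv-pos (suc k) (y ∷ ys) (ℕ.s≤s k≤n) = subst (0ℚ <_) (sym (symInv-cons k (suc y) (map suc ys)))
    (ℚP.<-≤-trans (*-pos (inv-pos y) (symInv-pos k ys k≤n))
                  (p≤p+q _ (symInv-nonNeg (suc k) (map suc ys))))

  sumInv-nonNeg : ∀ xs → 0ℚ ≤ sumInv xs
  sumInv-nonNeg []       = ℚP.≤-refl
  sumInv-nonNeg (x ∷ xs) = +-nonNeg (inv-nonNeg x) (sumInv-nonNeg xs)

  symInv*!≤sumInv^ : ∀ k xs → symInv k xs * ι (k !) ≤ sumInv xs ^ k
  symInv*!≤sumInv^ zero    xs = ℚP.≤-reflexive (trans (cong (_* 1ℚ) (symInv-zero xs)) (ℚP.*-identityˡ 1ℚ))
  symInv*!≤sumInv^ (suc k) [] = ℚP.≤-trans (ℚP.≤-reflexive (ℚP.*-zeroˡ (ι (suc k !)))) (^-nonNeg ℚP.≤-refl (suc k))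
  symInv*!≤sumInv^ (suc k) (x ∷ xs) = begin
    symInv (suc k) (x ∷ xs) * ι (suc k !)
      ≡⟨ cong₂ _*_ (symInv-cons k x xs) (ι-homo-* (suc k) (k !)) ⟩
    (a * symInv k xs + symInv (suc k) xs) * (K * ι (k !))
      ≡⟨ QS.solve 5 (λ a e f K F → (a :* e :+ f) :* (K :* F) := K :* a :* (e :* F) :+ f :* (K :* F))
                    refl a (symInv k xs) (symInv (suc k) xs) K (ι (k !)) ⟩
    K * a * (symInv k xs * ι (k !)) + symInv (suc k) xs * (K * ι (k !))
      ≡⟨ cong (λ z → K * a * (symInv k xs * ι (k !)) + symInv (suc k) xs * z) (sym (ι-homo-* (suc k) (k !))) ⟩
    K * a * (symInv k xs * ι (k !)) + symInv (suc k) xs * ι (suc k !)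
      ≤⟨ ℚP.+-mono-≤ (*-monoˡ-≤ (K * a) (*-nonNeg (ι-nonNeg (suc k)) (inv-nonNeg x)) (symInv*!≤sumInv^ k xs))
                     (symInv*!≤sumInv^ (suc k) xs) ⟩
    K * a * h ^ k + h ^ suc k
      ≡⟨ ℚP.+-comm (K * a * h ^ k) (h ^ suc k) ⟩
    h ^ suc k + K * a * h ^ k
      ≤⟨ [a+d]^[1+p]≥two-terms (sumInv-nonNeg xs) (inv-nonNeg x) k ⟩
    (h + a) ^ suc k
      ≡⟨ cong (_^ suc k) (ℚP.+-comm h a) ⟩
    sumInv (x ∷ xs) ^ suc k
      ∎
    where
    open ℚP.≤-Reasoning
    open QS using (_:+_; _:*_; _:=_)
    a : ℚ
    a = inv x
    h : ℚ
    h = sumInv xs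
    K : ℚ
    K = ι (suc k)

  symInv<1 : ∀ k xs {E} → 0ℚ ≤ E → E * sumInv xs ≤ ι (suc k) →
             ι (suc k) ^ suc k < E ^ suc k * ι (suc k !) → symInv (suc k) xs < 1ℚ
  symInv<1 k xs {E} E≥0 EH≤K K^K<E^K*K! = ℚP.*-cancelʳ-<-nonNeg (ι (suc k !)) {{ℚ.nonNegative (ι-nonNeg (suc k !))}}
    (begin-strict
      symInv (suc k) xs * ι (suc k !)   ≤⟨ symInv*!≤sumInv^ (suc k) xs ⟩
      H ^ suc k                         <⟨ H^K<K! ⟩
      ι (suc k !)                       ≡⟨ sym (ℚP.*-identityˡ (ι (suc k !))) ⟩
      1ℚ * ι (suc k !)                  ∎)
    where
    open ℚP.≤-Reasoning
    H : ℚ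
    H = sumInv xs
    E^K*H^K<E^K*K! : E ^ suc k * H ^ suc k < E ^ suc k * ι (suc k !)
    E^K*H^K<E^K*K! = begin-strict
      E ^ suc k * H ^ suc k   ≡⟨ sym (^-distribʳ-* E H (suc k)) ⟩
      (E * H) ^ suc k         ≤⟨ ^-monoˡ-≤ (*-nonNeg E≥0 (sumInv-nonNeg xs)) EH≤K (suc k) ⟩
      ι (suc k) ^ suc k       <⟨ K^K<E^K*K! ⟩
      E ^ suc k * ι (suc k !) ∎
    H^K<K! : H ^ suc k < ι (suc k !)
    H^K<K! = ℚP.*-cancelˡ-<-nonNeg (E ^ suc k) {{ℚ.nonNegative (^-nonNeg E≥0 (suc k))}} E^K*H^K<E^K*K!

  1/! : ℕ → ℚ
  1/! i = _/_ (+ 1) (i !) {{ℕP._!≢0 i}}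

  eApprox≡∑ : ∀ m → eApprox m ≡ ∑ 1/! m
  eApprox≡∑ = sumℚ-map-upTo 1/!

  1/!-nonNeg : ∀ i → 0ℚ ≤ 1/! i
  1/!-nonNeg i = ℚP.nonNegative⁻¹ (1/! i) {{ℚP.normalize-nonNeg 1 (i !) {{ℕP._!≢0 i}}}}

  eApprox-nonNeg : ∀ m → 0ℚ ≤ eApprox m
  eApprox-nonNeg m = subst (0ℚ ≤_) (sym (eApprox≡∑ m)) (∑-nonNeg 1/!-nonNeg m)

  1/!*!≡1 : ∀ i → 1/! i * ι (i !) ≡ 1ℚ
  1/!*!≡1 i = x/d*d≡x 1 (i !) {{ℕP._!≢0 i}}

  1/!≡[1+i]*1/[1+i]! : ∀ i → 1/! i ≡ ι (suc i) * 1/! (suc i)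
  1/!≡[1+i]*1/[1+i]! i = *-cancelʳ-≡ _ _ (ι (i !)) (ι-mono-< {0} {i !} (ℕP.1≤n! i)) (begin
    1/! i * ι (i !)                              ≡⟨ 1/!*!≡1 i ⟩
    1ℚ                                           ≡⟨ sym (1/!*!≡1 (suc i)) ⟩
    1/! (suc i) * ι (suc i !)                    ≡⟨ cong (1/! (suc i) *_) (ι-homo-* (suc i) (i !)) ⟩
    1/! (suc i) * (ι (suc i) * ι (i !))          ≡⟨ QS.solve 3 (λ a b c → b :* (a :* c) := a :* b :* c)
                                                      refl (ι (suc i)) (1/! (suc i)) (ι (i !)) ⟩
    ι (suc i) * 1/! (suc i) * ι (i !)            ∎)
    where
    open ≡-Reasoning
    open QS using (_:*_; _:=_)

  1<∑1/! : ∀ {m} → 2 ℕ.≤ m → 1ℚ < ∑ 1/! m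
  1<∑1/! 2≤m = ℚP.<-≤-trans (ι-mono-< {1} {2} ℕP.≤-refl) (∑-monoʳ-≤ 1/!-nonNeg 2≤m)

  expSum : ℕ → ℚ → ℚ
  expSum N y = ∑ (λ i → y ^ i * 1/! i) N

  [y+x]^[1+N]/[1+N]!≥two-terms : ∀ {x y} → 0ℚ ≤ x → 0ℚ ≤ y → ∀ N →
    y ^ suc N * 1/! (suc N) + x * (y ^ N * 1/! N) ≤ (y + x) ^ suc N * 1/! (suc N)
  [y+x]^[1+N]/[1+N]!≥two-terms {x} {y} x≥0 y≥0 N = begin
    y ^ suc N * c + x * (y ^ N * 1/! N)
      ≡⟨ cong (λ z → y ^ suc N * c + x * (y ^ N * z)) (1/!≡[1+i]*1/[1+i]! N) ⟩
    y ^ suc N * c + x * (y ^ N * (ι (suc N) * c))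
      ≡⟨ QS.solve 5 (λ A c x B J → A :* c :+ x :* (B :* (J :* c)) := (A :+ J :* x :* B) :* c)
                    refl (y ^ suc N) c x (y ^ N) (ι (suc N)) ⟩
    (y ^ suc N + ι (suc N) * x * y ^ N) * c
      ≤⟨ *-monoʳ-≤ c (1/!-nonNeg (suc N)) ([a+d]^[1+p]≥two-terms y≥0 x≥0 N) ⟩
    (y + x) ^ suc N * c
      ∎
    where
    open ℚP.≤-Reasoning
    open QS using (_:+_; _:*_; _:=_)
    c : ℚ
    c = 1/! (suc N)

  expSum+x*expSum≤expSum : ∀ {x} → 0ℚ ≤ x → ∀ p N →
    expSum (suc N) (ι p * x) + x * expSum N (ι p * x) ≤ expSum (suc N) (ι (suc p) * x)
  expSum+x*expSum≤expSum {x} x≥0 p zero = ℚP.≤-reflexive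
    (QS.solve 2 (λ x c → (con 0ℚ :+ con 1ℚ :* c) :+ x :* con 0ℚ := con 0ℚ :+ con 1ℚ :* c) refl x (1/! 0))
    where open QS
  expSum+x*expSum≤expSum {x} x≥0 p (suc N) = begin
    (expSum (suc N) y + A) + x * (expSum N y + B)
      ≡⟨ QS.solve 5 (λ F A G x B → (F :+ A) :+ x :* (G :+ B) := (F :+ x :* G) :+ (A :+ x :* B))
                    refl (expSum (suc N) y) A (expSum N y) x B ⟩
    (expSum (suc N) y + x * expSum N y) + (A + x * B)
      ≤⟨ ℚP.+-mono-≤ (expSum+x*expSum≤expSum x≥0 p N) ([y+x]^[1+N]/[1+N]!≥two-terms x≥0 (*-nonNeg (ι-nonNeg p) x≥0) N) ⟩
    expSum (suc N) (ι (suc p) * x) + (y + x) ^ suc N * 1/! (suc N)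
      ≡⟨ cong (λ z → expSum (suc N) (ι (suc p) * x) + z ^ suc N * 1/! (suc N)) (sym [1+p]x≡px+x) ⟩
    expSum (suc (suc N)) (ι (suc p) * x)
      ∎
    where
    open ℚP.≤-Reasoning
    open QS using (_:+_; _:*_; _:=_; con)
    y : ℚ
    y = ι p * x
    A : ℚ
    A = y ^ suc N * 1/! (suc N)
    B : ℚ
    B = y ^ N * 1/! N
    [1+p]x≡px+x : ι (suc p) * x ≡ y + x
    [1+p]x≡px+x = trans (cong (_* x) (ι-homo-+ 1 p)) (QS.solve 2 (λ a x → (con 1ℚ :+ a) :* x := a :* x :+ x) refl (ι p) x)

  [1+x]*expSum≤expSum : ∀ {x} → 0ℚ ≤ x → ∀ p N → (1ℚ + x) * expSum N (ι p * x) ≤ expSum (suc N) (ι (suc p) * x)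
  [1+x]*expSum≤expSum {x} x≥0 p N = begin
    (1ℚ + x) * expSum N y                  ≡⟨ QS.solve 2 (λ x F → (con 1ℚ :+ x) :* F := F :+ x :* F) refl x (expSum N y) ⟩
    expSum N y + x * expSum N y            ≤⟨ ℚP.+-monoˡ-≤ (x * expSum N y) (∑-monoʳ-≤ term≥0 (ℕP.n≤1+n N)) ⟩
    expSum (suc N) y + x * expSum N y      ≤⟨ expSum+x*expSum≤expSum x≥0 p N ⟩
    expSum (suc N) (ι (suc p) * x)         ∎
    where
    open ℚP.≤-Reasoning
    open QS using (_:+_; _:*_; _:=_; con)
    y : ℚ
    y = ι p * x
    term≥0 : ∀ i → 0ℚ ≤ y ^ i * 1/! i
    term≥0 i = *-nonNeg (^-nonNeg (*-nonNeg (ι-nonNeg p) x≥0) i) (1/!-nonNeg i)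

  [1+x]^p≤expSum : ∀ {x} → 0ℚ ≤ x → ∀ p → (1ℚ + x) ^ p ≤ expSum (suc p) (ι p * x)
  [1+x]^p≤expSum x≥0 zero    = ℚP.≤-refl
  [1+x]^p≤expSum x≥0 (suc p) =
    ℚP.≤-trans (*-monoˡ-≤ _ (+-nonNeg (ι-nonNeg 1) x≥0) ([1+x]^p≤expSum x≥0 p)) ([1+x]*expSum≤expSum x≥0 p (suc p))

  [J+1]^J≤e*J^J : ∀ j {m} → suc (suc j) ℕ.≤ m → ι (suc (suc j)) ^ suc j ≤ ∑ 1/! m * ι (suc j) ^ suc j
  [J+1]^J≤e*J^J j {m} J+1≤m = begin
    ι (suc J) ^ J                 ≡⟨ cong (_^ J) J+1≡[1+x]*J ⟩
    ((1ℚ + x) * ι J) ^ J          ≡⟨ ^-distribʳ-* (1ℚ + x) (ι J) J ⟩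
    (1ℚ + x) ^ J * ι J ^ J        ≤⟨ *-monoʳ-≤ (ι J ^ J) (^-nonNeg (ι-nonNeg J) J) [1+x]^J≤e ⟩
    ∑ 1/! m * ι J ^ J             ∎
    where
    open ℚP.≤-Reasoning
    J : ℕ
    J = suc j
    x : ℚ
    x = + 1 / J
    x*J≡1 : x * ι J ≡ 1ℚ
    x*J≡1 = x/d*d≡x 1 J
    J+1≡[1+x]*J : ι (suc J) ≡ (1ℚ + x) * ι J
    J+1≡[1+x]*J = trans (ι-homo-+ 1 J) (trans (cong (_+ ι J) (sym x*J≡1))
      (QS.solve 2 (λ x a → x :* a :+ a := (con 1ℚ :+ x) :* a) refl x (ι J)))
      where open QS
    expSum-at-1 : expSum (suc J) (ι J * x) ≡ ∑ 1/! (suc J)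
    expSum-at-1 = trans (cong (expSum (suc J)) (trans (ℚP.*-comm (ι J) x) x*J≡1))
      (∑-cong (λ i → trans (cong (_* 1/! i) (1^n≡1 i)) (ℚP.*-identityˡ (1/! i))) (suc J))
    [1+x]^J≤e : (1ℚ + x) ^ J ≤ ∑ 1/! m
    [1+x]^J≤e = ℚP.≤-trans ([1+x]^p≤expSum (inv-nonNeg J) J)
      (ℚP.≤-trans (ℚP.≤-reflexive expSum-at-1) (∑-monoʳ-≤ 1/!-nonNeg J+1≤m))

  K^K≤e^[K-1]*K! : ∀ j {m} → suc j ℕ.≤ m → ι (suc j) ^ suc j ≤ ∑ 1/! m ^ j * ι (suc j !)
  K^K≤e^[K-1]*K! zero        _     = ℚP.≤-refl
  K^K≤e^[K-1]*K! (suc i) {m} J+1≤m = begin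
    K * K ^ J                       ≤⟨ *-monoˡ-≤ K (ι-nonNeg (suc J)) ([J+1]^J≤e*J^J i J+1≤m) ⟩
    K * (E * ι J ^ J)               ≤⟨ *-monoˡ-≤ K (ι-nonNeg (suc J)) (*-monoˡ-≤ E E≥0
                                         (K^K≤e^[K-1]*K! i (ℕP.≤-trans (ℕP.n≤1+n J) J+1≤m))) ⟩
    K * (E * (E ^ i * ι (J !)))     ≡⟨ QS.solve 4 (λ K E P F → K :* (E :* (P :* F)) := E :* P :* (K :* F))
                                         refl K E (E ^ i) (ι (J !)) ⟩
    E ^ J * (K * ι (J !))           ≡⟨ cong (E ^ J *_) (sym (ι-homo-* (suc J) (J !))) ⟩
    E ^ J * ι (suc J !)             ∎
    where
    open ℚP.≤-Reasoning
    open QS using (_:*_; _:=_)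
    J : ℕ
    J = suc i
    K : ℚ
    K = ι (suc J)
    E : ℚ
    E = ∑ 1/! m
    E≥0 : 0ℚ ≤ E
    E≥0 = ∑-nonNeg 1/!-nonNeg m

  K^K<e^K*K! : ∀ k {m} → suc (suc k) ℕ.≤ m → ι (suc k) ^ suc k < eApprox m ^ suc k * ι (suc k !)
  K^K<e^K*K! k {m} K+1≤m rewrite eApprox≡∑ m = begin-strict
    ι (suc k) ^ suc k      ≤⟨ K^K≤e^[K-1]*K! k (ℕP.≤-trans (ℕP.n≤1+n (suc k)) K+1≤m) ⟩
    X                      ≡⟨ sym (ℚP.*-identityˡ X) ⟩
    1ℚ * X                 <⟨ ℚP.*-monoˡ-<-pos X {{ℚ.positive X>0}} E>1 ⟩
    E * X                  ≡⟨ sym (ℚP.*-assoc E (E ^ k) (ι (suc k !))) ⟩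
    E ^ suc k * ι (suc k !) ∎
    where
    open ℚP.≤-Reasoning
    E : ℚ
    E = ∑ 1/! m
    E>1 : 1ℚ < E
    E>1 = 1<∑1/! (ℕP.≤-trans (ℕ.s≤s (ℕ.s≤s ℕ.z≤n)) K+1≤m)
    X : ℚ
    X = E ^ k * ι (suc k !)
    X>0 : 0ℚ < X
    X>0 = *-pos (^-pos (ℚP.<-trans (ι-pos 0) E>1) k) (ι-mono-< {0} {suc k !} (ℕP.1≤n! (suc k)))

  -- Bernoulli's inequality (1 + 2/a)^(m+1) ≥ 1 + 2(m+1)/a, cleared of denominators.
  a^m*[a+2[1+m]]≤[2+a]^[1+m] : ∀ a m → a ℕ.^ m ℕ.* (a ℕ.+ 2 ℕ.* suc m) ℕ.≤ (2 ℕ.+ a) ℕ.^ suc m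
  a^m*[a+2[1+m]]≤[2+a]^[1+m] a zero = ℕP.≤-reflexive
    (NS.solve 1 (λ a → con 1 :* (a :+ con 2 :* con 1) := (con 2 :+ a) :* con 1) refl a)
    where open NS
  a^m*[a+2[1+m]]≤[2+a]^[1+m] a (suc m) = begin
    a ℕ.^ suc m ℕ.* (a ℕ.+ 2 ℕ.* suc (suc m))                       ≡⟨ expand ⟩
    a ℕ.* P ℕ.* (a ℕ.+ 2 ℕ.* m ℕ.+ 4)                              ≤⟨ ℕP.m≤m+n _ _ ⟩
    a ℕ.* P ℕ.* (a ℕ.+ 2 ℕ.* m ℕ.+ 4) ℕ.+ P ℕ.* (4 ℕ.* m ℕ.+ 4)     ≡⟨ regroup ⟩
    (2 ℕ.+ a) ℕ.* (P ℕ.* (a ℕ.+ 2 ℕ.* suc m))                       ≤⟨ ℕP.*-monoʳ-≤ (2 ℕ.+ a) IH ⟩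
    (2 ℕ.+ a) ℕ.^ suc (suc m)                                       ∎
    where
    open ℕP.≤-Reasoning
    open NS using (_:+_; _:*_; _:=_; con)
    P : ℕ
    P = a ℕ.^ m
    expand : a ℕ.^ suc m ℕ.* (a ℕ.+ 2 ℕ.* suc (suc m)) ≡ a ℕ.* P ℕ.* (a ℕ.+ 2 ℕ.* m ℕ.+ 4)
    expand = NS.solve 3 (λ a P m → a :* P :* (a :+ con 2 :* (con 2 :+ m)) := a :* P :* (a :+ con 2 :* m :+ con 4))
                        refl a P m
    IH : P ℕ.* (a ℕ.+ 2 ℕ.* suc m) ℕ.≤ (2 ℕ.+ a) ℕ.^ suc m
    IH = a^m*[a+2[1+m]]≤[2+a]^[1+m] a m
    regroup : a ℕ.* P ℕ.* (a ℕ.+ 2 ℕ.* m ℕ.+ 4) ℕ.+ P ℕ.* (4 ℕ.* m ℕ.+ 4)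
              ≡ (2 ℕ.+ a) ℕ.* (P ℕ.* (a ℕ.+ 2 ℕ.* suc m))
    regroup = NS.solve 3 (λ a P m → a :* P :* (a :+ con 2 :* m :+ con 4) :+ P :* (con 4 :* m :+ con 4)
                                    := (con 2 :+ a) :* (P :* (a :+ con 2 :* (con 1 :+ m))))
                         refl a P m

  a^[1+m]*[2+a]≤[2+a]^[1+m] : ∀ a m → a ℕ.* a ℕ.+ a ℕ.≤ 2 ℕ.* suc m →
                              a ℕ.^ suc m ℕ.* (2 ℕ.+ a) ℕ.≤ (2 ℕ.+ a) ℕ.^ suc m
  a^[1+m]*[2+a]≤[2+a]^[1+m] a m a²+a≤2[1+m] = begin
    a ℕ.^ suc m ℕ.* (2 ℕ.+ a)
      ≡⟨ NS.solve 2 (λ a P → a :* P :* (con 2 :+ a) := P :* (a :+ (a :* a :+ a))) refl a (a ℕ.^ m) ⟩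
    a ℕ.^ m ℕ.* (a ℕ.+ (a ℕ.* a ℕ.+ a))
      ≤⟨ ℕP.*-monoʳ-≤ (a ℕ.^ m) (ℕP.+-monoʳ-≤ a a²+a≤2[1+m]) ⟩
    a ℕ.^ m ℕ.* (a ℕ.+ 2 ℕ.* suc m)
      ≤⟨ a^m*[a+2[1+m]]≤[2+a]^[1+m] a m ⟩
    (2 ℕ.+ a) ℕ.^ suc m
      ∎
    where
    open ℕP.≤-Reasoning
    open NS using (_:+_; _:*_; _:=_; con)

  a^[2N]*[2+a]²≤[2+a]^[2N] : ∀ a m → a ℕ.* a ℕ.+ a ℕ.≤ 2 ℕ.* suc m →
                            a ℕ.^ (2 ℕ.* suc m) ℕ.* (2 ℕ.+ a) ℕ.^ 2 ℕ.≤ (2 ℕ.+ a) ℕ.^ (2 ℕ.* suc m)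
  a^[2N]*[2+a]²≤[2+a]^[2N] a m a²+a≤2[1+m] = begin
    a ℕ.^ (2 ℕ.* suc m) ℕ.* (2 ℕ.+ a) ℕ.^ 2
      ≡⟨ cong (ℕ._* (2 ℕ.+ a) ℕ.^ 2) (x^[2n]≡x^n*x^n a (suc m)) ⟩
    X ℕ.* X ℕ.* (2 ℕ.+ a) ℕ.^ 2
      ≡⟨ NS.solve 2 (λ X b → X :* X :* (b :* (b :* con 1)) := (X :* b) :* (X :* b)) refl X (2 ℕ.+ a) ⟩
    (X ℕ.* (2 ℕ.+ a)) ℕ.* (X ℕ.* (2 ℕ.+ a))
      ≤⟨ ℕP.*-mono-≤ X*[2+a]≤[2+a]^[1+m] X*[2+a]≤[2+a]^[1+m] ⟩
    (2 ℕ.+ a) ℕ.^ suc m ℕ.* (2 ℕ.+ a) ℕ.^ suc m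
      ≡⟨ sym (x^[2n]≡x^n*x^n (2 ℕ.+ a) (suc m)) ⟩
    (2 ℕ.+ a) ℕ.^ (2 ℕ.* suc m)
      ∎
    where
    open ℕP.≤-Reasoning
    open NS using (_:*_; _:=_; con)
    X : ℕ
    X = a ℕ.^ suc m
    X*[2+a]≤[2+a]^[1+m] : X ℕ.* (2 ℕ.+ a) ℕ.≤ (2 ℕ.+ a) ℕ.^ suc m
    X*[2+a]≤[2+a]^[1+m] = a^[1+m]*[2+a]≤[2+a]^[1+m] a m a²+a≤2[1+m]
    x^[2n]≡x^n*x^n : ∀ x n → x ℕ.^ (2 ℕ.* n) ≡ x ℕ.^ n ℕ.* x ℕ.^ n
    x^[2n]≡x^n*x^n x n = trans (ℕP.^-distribˡ-+-* x n (n ℕ.+ 0)) (cong (λ z → x ℕ.^ n ℕ.* x ℕ.^ z) (ℕP.+-identityʳ n))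

  artanhTerm : ℚ → ℕ → ℚ
  artanhTerm u j = u ^ suc (2 ℕ.* j) * (+ 1 / suc (2 ℕ.* j))

  artanhSum : ℕ → ℚ → ℚ
  artanhSum m u = ∑ (artanhTerm u) m

  evenPowSum : ℕ → ℚ → ℚ
  evenPowSum m a = ∑ (λ j → a ^ (2 ℕ.* j)) m

  artanhSum-nonNeg : ∀ m {u} → 0ℚ ≤ u → 0ℚ ≤ artanhSum m u
  artanhSum-nonNeg m u≥0 = ∑-nonNeg (λ j → *-nonNeg (^-nonNeg u≥0 (suc (2 ℕ.* j))) (inv-nonNeg (suc (2 ℕ.* j)))) m

  artanhTerm-+-≥ : ∀ {a d} → 0ℚ ≤ a → 0ℚ ≤ d → ∀ j → artanhTerm a j + d * a ^ (2 ℕ.* j) ≤ artanhTerm (a + d) j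
  artanhTerm-+-≥ {a} {d} a≥0 d≥0 j = begin
    a ^ suc p * c + d * a ^ p                   ≡⟨ cong (_+_ (a ^ suc p * c)) (x≡x*u c*J≡1 (d * a ^ p)) ⟩
    a ^ suc p * c + d * a ^ p * (c * J)         ≡⟨ QS.solve 5 (λ X c d P J → X :* c :+ d :* P :* (c :* J) := (X :+ J :* d :* P) :* c)
                                                      refl (a ^ suc p) c d (a ^ p) J ⟩
    (a ^ suc p + J * d * a ^ p) * c             ≤⟨ *-monoʳ-≤ c (inv-nonNeg (suc p)) ([a+d]^[1+p]≥two-terms a≥0 d≥0 p) ⟩
    (a + d) ^ suc p * c                         ∎
    where
    open ℚP.≤-Reasoning
    open QS using (_:+_; _:*_; _:=_)
    p : ℕ
    p = 2 ℕ.* j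
    c : ℚ
    c = + 1 / suc p
    J : ℚ
    J = ι (suc p)
    c*J≡1 : c * J ≡ 1ℚ
    c*J≡1 = x/d*d≡x 1 (suc p)

  -- The discrete form of artanh(a + d) ≥ artanh(a) + d·artanh′(a) for the truncated series.
  artanhSum-+-≥ : ∀ m {a d} → 0ℚ ≤ a → 0ℚ ≤ d → artanhSum m a + d * evenPowSum m a ≤ artanhSum m (a + d)
  artanhSum-+-≥ m {a} {d} a≥0 d≥0 = begin
    artanhSum m a + d * evenPowSum m a                      ≡⟨ cong (_+_ (artanhSum m a)) (sym (∑-*ˡ d (λ j → a ^ (2 ℕ.* j)) m)) ⟩
    artanhSum m a + ∑ (λ j → d * a ^ (2 ℕ.* j)) m           ≡⟨ sym (∑-distrib-+ (artanhTerm a) (λ j → d * a ^ (2 ℕ.* j)) m) ⟩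
    ∑ (λ j → artanhTerm a j + d * a ^ (2 ℕ.* j)) m          ≤⟨ ∑-mono-≤ (artanhTerm-+-≥ a≥0 d≥0) m ⟩
    artanhSum m (a + d)                                     ∎
    where open ℚP.≤-Reasoning

  evenPowSum*[1-a²]≡1-a^[2m] : ∀ a m → evenPowSum m a * (1ℚ - a * a) ≡ 1ℚ - a ^ (2 ℕ.* m)
  evenPowSum*[1-a²]≡1-a^[2m] a zero = QS.solve 1 (λ a → con 0ℚ :* (con 1ℚ :- a :* a) := con 1ℚ :- con 1ℚ) refl a
    where open QS
  evenPowSum*[1-a²]≡1-a^[2m] a (suc m) = begin
    (G + P) * (1ℚ - a * a)
      ≡⟨ QS.solve 3 (λ G P a → (G :+ P) :* (con 1ℚ :- a :* a) := G :* (con 1ℚ :- a :* a) :+ (P :- a :* (a :* P)))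
                    refl G P a ⟩
    G * (1ℚ - a * a) + (P - a * (a * P))
      ≡⟨ cong (_+ (P - a * (a * P))) (evenPowSum*[1-a²]≡1-a^[2m] a m) ⟩
    1ℚ - P + (P - a * (a * P))
      ≡⟨ QS.solve 2 (λ P aaP → con 1ℚ :- P :+ (P :- aaP) := con 1ℚ :- aaP) refl P (a * (a * P)) ⟩
    1ℚ - a * (a * P)
      ≡⟨ cong (λ n → 1ℚ - a ^ n) (sym (ℕP.*-suc 2 m)) ⟩
    1ℚ - a ^ (2 ℕ.* suc m)
      ∎
    where
    open ≡-Reasoning
    open QS using (_:+_; _:*_; _:=_; _:-_; con)
    G : ℚ
    G = evenPowSum m a
    P : ℚ
    P = a ^ (2 ℕ.* m)

  ratio : ℕ → ℚ
  ratio n = + (n ℕ.∸ 1) / suc n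

  module Increment (r : ℕ) where

    R : ℚ
    R = ι r
    w : ℚ
    w = + 1 / suc (suc r)
    v : ℚ
    v = + 1 / suc (suc (suc r))
    a : ℚ
    a = ratio (suc r)
    b : ℚ
    b = ratio (suc (suc r))
    d : ℚ
    d = ι 2 * w * v
    I : ℚ
    I = ι (suc (suc r))

    w*I≡1 : w * I ≡ 1ℚ
    w*I≡1 = x/d*d≡x 1 (suc (suc r))

    w*[2+R]≡1 : w * (ι 2 + R) ≡ 1ℚ
    w*[2+R]≡1 = trans (cong (w *_) (sym (ι-homo-+ 2 r))) w*I≡1

    [w*[2+R]]²≡1 : w * (ι 2 + R) * (w * (ι 2 + R)) ≡ 1ℚ
    [w*[2+R]]²≡1 = trans (cong₂ _*_ w*[2+R]≡1 w*[2+R]≡1) (ℚP.*-identityˡ 1ℚ)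

    v*[3+R]≡1 : v * (ι 3 + R) ≡ 1ℚ
    v*[3+R]≡1 = trans (cong (v *_) (sym (ι-homo-+ 3 r))) (x/d*d≡x 1 (suc (suc (suc r))))

    a≡R*w : a ≡ R * w
    a≡R*w = x/d≡x*1/d r (suc r)

    a≥0 : 0ℚ ≤ a
    a≥0 = /-nonNeg r (suc r)

    d≥0 : 0ℚ ≤ d
    d≥0 = *-nonNeg (*-nonNeg (ι-nonNeg 2) (inv-nonNeg (suc (suc r)))) (inv-nonNeg (suc (suc (suc r))))

    a+d≡b : a + d ≡ b
    a+d≡b = begin
      a + d                                   ≡⟨ cong (_+ d) (trans a≡R*w (x≡x*u v*[3+R]≡1 (R * w))) ⟩
      R * w * (v * (ι 3 + R)) + ι 2 * w * v   ≡⟨ QS.solve 3 (λ R w v → R :* w :* (v :* (con (ι 3) :+ R)) :+ con (ι 2) :* w :* v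
                                                                   := (con 1ℚ :+ R) :* v :* (w :* (con (ι 2) :+ R))) refl R w v ⟩
      (1ℚ + R) * v * (w * (ι 2 + R))          ≡⟨ sym (x≡x*u w*[2+R]≡1 ((1ℚ + R) * v)) ⟩
      (1ℚ + R) * v                            ≡⟨ cong (_* v) (sym (ι-homo-+ 1 r)) ⟩
      ι (suc r) * v                           ≡⟨ sym (x/d≡x*1/d (suc r) (suc (suc r))) ⟩
      b                                       ∎
      where
      open ≡-Reasoning
      open QS using (_:+_; _:*_; _:=_; con)

    1-a²≡w²*4[1+R] : 1ℚ - a * a ≡ w * w * (ι 4 * (1ℚ + R))
    1-a²≡w²*4[1+R] = begin
      1ℚ - a * a                                    ≡⟨ cong₂ (λ x y → x - y * y) (sym [w*[2+R]]²≡1) a≡R*w ⟩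
      w * (ι 2 + R) * (w * (ι 2 + R)) - R * w * (R * w)
        ≡⟨ QS.solve 2 (λ R w → (w :* (con (ι 2) :+ R)) :* (w :* (con (ι 2) :+ R)) :- (R :* w) :* (R :* w)
                                := w :* w :* (con (ι 4) :* (con 1ℚ :+ R))) refl R w ⟩
      w * w * (ι 4 * (1ℚ + R))                      ∎
      where
      open ≡-Reasoning
      open QS using (_:+_; _:*_; _:=_; _:-_; con)

    1-a²>0 : 0ℚ < 1ℚ - a * a
    1-a²>0 = subst (0ℚ <_) (sym 1-a²≡w²*4[1+R])
      (*-pos (*-pos (inv-pos (suc r)) (inv-pos (suc r))) (*-pos (ι-pos 3) (subst (0ℚ <_) (ι-homo-+ 1 r) (ι-pos r))))

    w*[1-a²]≡2d*[1-w²] : w * (1ℚ - a * a) ≡ ι 2 * d * (1ℚ - w * w)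
    w*[1-a²]≡2d*[1-w²] = begin
      w * (1ℚ - a * a)                                        ≡⟨ cong (w *_) 1-a²≡w²*4[1+R] ⟩
      w * (w * w * (ι 4 * (1ℚ + R)))                          ≡⟨ x≡x*u v*[3+R]≡1 _ ⟩
      w * (w * w * (ι 4 * (1ℚ + R))) * (v * (ι 3 + R))
        ≡⟨ QS.solve 3 (λ R w v → w :* (w :* w :* (con (ι 4) :* (con 1ℚ :+ R))) :* (v :* (con (ι 3) :+ R))
                                  := con (ι 2) :* (con (ι 2) :* w :* v) :* ((w :* (con (ι 2) :+ R)) :* (w :* (con (ι 2) :+ R)) :- w :* w))
                      refl R w v ⟩
      ι 2 * d * (w * (ι 2 + R) * (w * (ι 2 + R)) - w * w)     ≡⟨ cong (λ z → ι 2 * d * (z - w * w)) [w*[2+R]]²≡1 ⟩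
      ι 2 * d * (1ℚ - w * w)                                  ∎
      where
      open ≡-Reasoning
      open QS using (_:+_; _:*_; _:=_; _:-_; con)

    w≤2d*evenPowSum : ∀ m → a ^ (2 ℕ.* m) ≤ w * w → w ≤ ι 2 * d * evenPowSum m a
    w≤2d*evenPowSum m a^2m≤w² = ℚP.*-cancelʳ-≤-pos (1ℚ - a * a) {{ℚ.positive 1-a²>0}} (begin
      w * (1ℚ - a * a)                          ≡⟨ w*[1-a²]≡2d*[1-w²] ⟩
      ι 2 * d * (1ℚ - w * w)                    ≤⟨ *-monoˡ-≤ (ι 2 * d) (*-nonNeg (ι-nonNeg 2) d≥0)
                                                     (ℚP.+-monoʳ-≤ 1ℚ (ℚP.neg-antimono-≤ a^2m≤w²)) ⟩
      ι 2 * d * (1ℚ - a ^ (2 ℕ.* m))            ≡⟨ cong (ι 2 * d *_) (sym (evenPowSum*[1-a²]≡1-a^[2m] a m)) ⟩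
      ι 2 * d * (evenPowSum m a * (1ℚ - a * a)) ≡⟨ sym (ℚP.*-assoc (ι 2 * d) (evenPowSum m a) (1ℚ - a * a)) ⟩
      ι 2 * d * evenPowSum m a * (1ℚ - a * a)   ∎)
      where open ℚP.≤-Reasoning

    a^[2N]≤w² : ∀ m → r ℕ.* r ℕ.+ r ℕ.≤ 2 ℕ.* suc m → a ^ (2 ℕ.* suc m) ≤ w * w
    a^[2N]≤w² m r²+r≤2N = begin
      a ^ N                                 ≡⟨ trans (cong (_^ N) a≡R*w) (^-distribʳ-* R w N) ⟩
      R ^ N * w ^ N                         ≡⟨ x≡x*u (trans (cong (_^ 2) w*I≡1) (1^n≡1 2)) _ ⟩
      R ^ N * w ^ N * (w * I) ^ 2           ≡⟨ cong (R ^ N * w ^ N *_) (^-distribʳ-* w I 2) ⟩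
      R ^ N * w ^ N * (w ^ 2 * I ^ 2)       ≡⟨ QS.solve 4 (λ a b c e → a :* b :* (c :* e) := (a :* e) :* (b :* c))
                                                 refl (R ^ N) (w ^ N) (w ^ 2) (I ^ 2) ⟩
      (R ^ N * I ^ 2) * (w ^ N * w ^ 2)     ≤⟨ *-monoʳ-≤ (w ^ N * w ^ 2) (*-nonNeg (^-nonNeg w≥0 N) (^-nonNeg w≥0 2)) R^N*I²≤I^N ⟩
      I ^ N * (w ^ N * w ^ 2)               ≡⟨ QS.solve 3 (λ a b c → a :* (b :* c) := (b :* a) :* c) refl (I ^ N) (w ^ N) (w ^ 2) ⟩
      (w ^ N * I ^ N) * w ^ 2               ≡⟨ cong (_* w ^ 2) (sym (^-distribʳ-* w I N)) ⟩
      (w * I) ^ N * w ^ 2                   ≡⟨ cong (λ z → z ^ N * w ^ 2) w*I≡1 ⟩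
      1ℚ ^ N * w ^ 2                        ≡⟨ cong (_* w ^ 2) (1^n≡1 N) ⟩
      1ℚ * w ^ 2                            ≡⟨ QS.solve 1 (λ w → con 1ℚ :* (w :* (w :* con 1ℚ)) := w :* w) refl w ⟩
      w * w                                 ∎
      where
      open ℚP.≤-Reasoning
      open QS using (_:*_; _:=_; con)
      N : ℕ
      N = 2 ℕ.* suc m
      w≥0 : 0ℚ ≤ w
      w≥0 = inv-nonNeg (suc (suc r))
      R^N*I²≤I^N : R ^ N * I ^ 2 ≤ I ^ N
      R^N*I²≤I^N = subst₂ _≤_
        (trans (ι-homo-* (r ℕ.^ N) ((2 ℕ.+ r) ℕ.^ 2)) (sym (cong₂ _*_ (ι-homo-^ r N) (ι-homo-^ (2 ℕ.+ r) 2))))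
        (sym (ι-homo-^ (2 ℕ.+ r) N))
        (ι-mono-≤ (a^[2N]*[2+a]²≤[2+a]^[2N] r m r²+r≤2N))

  harmonic : ℕ → ℚ
  harmonic n = ∑ (λ j → inv (suc j)) n

  harmonic≤1+2artanhSum : ∀ r {m} → r ℕ.* r ℕ.+ r ℕ.≤ 2 ℕ.* suc m →
                          harmonic (suc r) ≤ 1ℚ + ι 2 * artanhSum (suc m) (ratio (suc r))
  harmonic≤1+2artanhSum zero    {m} _ = p≤p+q 1ℚ (*-nonNeg (ι-nonNeg 2) (artanhSum-nonNeg (suc m) (/-nonNeg 0 1)))
  harmonic≤1+2artanhSum (suc r) {m} [1+r]²+[1+r]≤2N = begin
    harmonic (suc r) + w
      ≤⟨ ℚP.+-mono-≤ (harmonic≤1+2artanhSum r r²+r≤2N) (w≤2d*evenPowSum (suc m) (a^[2N]≤w² m r²+r≤2N)) ⟩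
    1ℚ + ι 2 * A a + ι 2 * d * G
      ≡⟨ QS.solve 4 (λ A d G two → con 1ℚ :+ two :* A :+ two :* d :* G := con 1ℚ :+ two :* (A :+ d :* G))
                    refl (A a) d G (ι 2) ⟩
    1ℚ + ι 2 * (A a + d * G)
      ≤⟨ ℚP.+-monoʳ-≤ 1ℚ (*-monoˡ-≤ (ι 2) (ι-nonNeg 2) (artanhSum-+-≥ (suc m) a≥0 d≥0)) ⟩
    1ℚ + ι 2 * A (a + d)
      ≡⟨ cong (λ z → 1ℚ + ι 2 * A z) a+d≡b ⟩
    1ℚ + ι 2 * A b
      ∎
    where
    open Increment r
    open ℚP.≤-Reasoning
    open QS using (_:+_; _:*_; _:=_; con)
    A : ℚ → ℚ
    A = artanhSum (suc m)
    G : ℚ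
    G = evenPowSum (suc m) a
    r²+r≤2N : r ℕ.* r ℕ.+ r ℕ.≤ 2 ℕ.* suc m
    r²+r≤2N = ℕP.≤-trans (ℕP.+-mono-≤ (ℕP.*-mono-≤ (ℕP.n≤1+n r) (ℕP.n≤1+n r)) (ℕP.n≤1+n r)) [1+r]²+[1+r]≤2N

  harmonic≤logApprox+1 : ∀ r {m} → r ℕ.* r ℕ.+ r ℕ.≤ 2 ℕ.* suc m → sumInv (oneTo (suc r)) ≤ logApprox (suc r) (suc m) + 1ℚ
  harmonic≤logApprox+1 r {m} r²+r≤2N = subst₂ _≤_ sumInv≡harmonic 1+L≡L+1 (harmonic≤1+2artanhSum r r²+r≤2N)
    where
    sumInv≡harmonic : harmonic (suc r) ≡ sumInv (oneTo (suc r))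
    sumInv≡harmonic = sym (trans (cong sumℚ (sym (LP.map-∘ {g = inv} {f = suc} (upTo (suc r)))))
                                 (sumℚ-map-upTo (λ j → inv (suc j)) (suc r)))
    1+L≡L+1 : 1ℚ + ι 2 * artanhSum (suc m) (ratio (suc r)) ≡ logApprox (suc r) (suc m) + 1ℚ
    1+L≡L+1 = trans (ℚP.+-comm 1ℚ (ι 2 * artanhSum (suc m) (ratio (suc r))))
                    (cong (λ z → ι 2 * z + 1ℚ) (sym (sumℚ-map-upTo (artanhTerm (ratio (suc r))) (suc m))))

open Estimates
open import Data.Nat using (ℕ; _≤_)

lemma3 : (k n : ℕ) → 1 ≤ k → 1 ≤ n → k ≤ n → ElogPlusE≤ n k → ¬ IsInteger (S k n)
lemma3 (suc k-1) (suc r) _ _ k≤n e[logn+1]≤k =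
  0<q<1⇒¬IsInteger (symInv-pos (suc k-1) (upTo n) (subst (suc k-1 ≤_) (sym (LP.length-upTo n)) k≤n))
                   (symInv<1 k-1 (oneTo n) (eApprox-nonNeg M) eH≤k (K^K<e^K*K! k-1 k+1≤M))
  where
  n : ℕ
  n = suc r
  M : ℕ
  M = suc (n ℕ.* n ℕ.+ n)
  r²+r≤2M : r ℕ.* r ℕ.+ r ≤ 2 ℕ.* M
  r²+r≤2M = ℕP.≤-trans (ℕP.+-mono-≤ (ℕP.*-mono-≤ (ℕP.n≤1+n r) (ℕP.n≤1+n r)) (ℕP.n≤1+n r))
                       (ℕP.≤-trans (ℕP.n≤1+n _) (ℕP.m≤m+n M (M ℕ.+ 0)))
  k+1≤M : suc (suc k-1) ≤ M
  k+1≤M = ℕ.s≤s (ℕP.≤-trans k≤n (ℕP.m≤n+m n (n ℕ.* n)))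
  eH≤k : eApprox M * sumInv (oneTo n) ℚ.≤ ι (suc k-1)
  eH≤k = ℚP.≤-trans (*-monoˡ-≤ (eApprox M) (eApprox-nonNeg M) (harmonic≤logApprox+1 r r²+r≤2M)) (e[logn+1]≤k M)
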